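{- Let $G$ be a connected graph such that $G$ does not have a spanning tree with at most $4$ leaves, and let $T$ be a maximal tree of $G$ with $5$ leaves. Then there does not exist a tree $T'$ in $G$ such that $T'$ has at most $4$ leaves and $V(T')=V(T)$.
   Context: All graphs are finite and simple. A tree in $G$ means a subgraph of $G$ that is a tree. A leaf of a tree is a vertex of degree one in the tree. A maximal tree of $G$ with $5$ leaves means a tree in $G$ with exactly $5$ leaves having the maximum number of vertices among all trees in $G$ with exactly $5$ leaves. -}

module Defs where

open import Data.Nat using (ℕ; zero; suc; _+_; _≤_; _≡ᵇ_)
open import Data.Bool using (Bool; true; false; _∧_)
open import Data.Fin using (Fin; zero; suc; inject₁; fromℕ)
open import Data.Fin.Subset using (Subset; ∣_∣; _∈_; ⊤)
open import Data.Vec using (tabulate; lookup)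
open import Data.Product using (Σ; ∃; _×_)
open import Function.Definitions using (Injective)
open import Relation.Binary.PropositionalEquality using (_≡_)
open import Relation.Binary.Construct.Closure.ReflexiveTransitive using (Star)
open import Relation.Nullary using (¬_)

record Graph (n : ℕ) : Set where
  field
    adj   : Fin n → Fin n → Bool
    sym   : ∀ u v → adj u v ≡ adj v u
    irref : ∀ v → adj v v ≡ false
open Graph public

Edge : ∀ {n} → (Fin n → Fin n → Bool) → Fin n → Fin n → Set
Edge E u v = E u v ≡ true

Connected : ∀ {n} → Graph n → Set
Connected {n} G = ∀ (u v : Fin n) → Star (Edge (adj G)) u v

record Subgraph {n : ℕ} (G : Graph n) : Set where
  field
    vs     : Subset n
    es     : Fin n → Fin n → Bool
    es-sym : ∀ u v → es u v ≡ es v u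
    es-adj : ∀ u v → es u v ≡ true → adj G u v ≡ true
    es-vsˡ : ∀ u v → es u v ≡ true → u ∈ vs
open Subgraph public

HasCycle : ∀ {n} → (Fin n → Fin n → Bool) → Set
HasCycle {n} E =
  Σ ℕ λ k → Σ (Fin (3 + k) → Fin n) λ f →
    Injective _≡_ _≡_ f ×
    (∀ (i : Fin (2 + k)) → Edge E (f (inject₁ i)) (f (suc i))) ×
    Edge E (f (fromℕ (2 + k))) (f zero)

IsTree : ∀ {n} {G : Graph n} → Subgraph G → Set
IsTree {n} T =
  (Σ (Fin n) λ v → v ∈ vs T) ×
  (∀ u v → u ∈ vs T → v ∈ vs T → Star (Edge (es T)) u v) ×
  ¬ HasCycle (es T)

record Tree {n : ℕ} (G : Graph n) : Set where
  field
    sub    : Subgraph G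
    isTree : IsTree sub
open Tree public

degree : ∀ {n} {G : Graph n} → Subgraph G → Fin n → ℕ
degree T v = ∣ tabulate (es T v) ∣

order : ∀ {n} {G : Graph n} → Tree G → ℕ
order T = ∣ vs (sub T) ∣

leaves : ∀ {n} {G : Graph n} → Tree G → ℕ
leaves T = ∣ tabulate (λ v → lookup (vs (sub T)) v ∧ (degree (sub T) v ≡ᵇ 1)) ∣

Spanning : ∀ {n} {G : Graph n} → Tree G → Set
Spanning T = vs (sub T) ≡ ⊤

MaximalTree5 : ∀ {n} (G : Graph n) → Tree G → Set
MaximalTree5 G T = leaves T ≡ 5 × (∀ (T' : Tree G) → leaves T' ≡ 5 → order T' ≤ order T)

-- Idea: a tree S with at most 4 leaves can be grown one vertex at a time.
-- As long as S is not spanning, connectivity of G gives an edge uw with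
-- u ∈ S and w ∉ S, and adding the pendant edge uw yields a tree S + uw with
-- one more vertex and at most max (leaves S + 1, 2) leaves: w is a new leaf,
-- u stops being a leaf unless S was the single vertex u, and nothing else
-- changes.  So the leaf count rises by at most one per step, and growing a
-- tree T' with V(T') = V(T) either reaches a spanning tree with at most 4
-- leaves (excluded by hypothesis) or a tree with exactly 5 leaves and more
-- vertices than T' (excluded by maximality of T).
module Submission where

open import Defs
open import Data.Nat using (ℕ; _≤_)
open import Data.Product using (Σ; _×_)
open import Relation.Binary.PropositionalEquality using (_≡_)
open import Relation.Nullary using (¬_)

open import Data.Nat using (zero; suc; _+_; _<_; _⊔_; _≡ᵇ_; z≤n; s≤s; s≤s⁻¹)
open import Data.Nat.Properties
  using (≤-trans; ≤-reflexive; <-≤-trans; <-trans; <⇒≱; n≮0; +-comm; +-suc; +-monoʳ-≤; +-monoˡ-≤;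
         n≤1+n; m≤n+m; m≤m⊔n; m≤n⊔m; ⊔-lub; m≤n⇒m<n∨m≡n; ≡ᵇ⇒≡; ≡⇒≡ᵇ; module ≤-Reasoning)
open import Data.Bool using (Bool; true; false; _∧_; _∨_)
open import Data.Bool.Properties using (∧-comm; ∨-comm; ∨-zeroʳ; ∨-identityʳ; T-≡)
open import Data.Fin using (Fin; zero; suc; _≟_; inject₁; fromℕ)
open import Data.Fin.Properties using (suc-injective; 0≢1+n; any?; all?; ¬∀⟶∃¬)
open import Data.Fin.Relation.Unary.Top using (view; ‵fromℕ; ‵inj₁)
open import Data.Fin.Subset using (Subset; ∣_∣; _∈_; _∉_; _⊆_; _∪_; _-_; ⁅_⁆; ⊤; inside; outside)
open import Data.Fin.Subset.Properties
  using (_∈?_; ⊆⊤; ⊆-antisym; p⊆q⇒∣p∣≤∣q∣; p⊂q⇒∣p∣<∣q∣; ∣p∣≤n; ∣⁅x⁆∣≡1; x∈⁅x⁆; x∈⁅y⁆⇒x≡y;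
         p⊆p∪q; q⊆p∪q; x∈p∪q⁻; x∈p⇒∣p-x∣<∣p∣)
open import Data.Vec using (tabulate; lookup; []; _∷_)
open import Data.Vec.Properties using (lookup∘tabulate; tabulate-cong; []=⇒lookup; lookup⇒[]=)
open import Data.Product using (∃; _,_; proj₁; proj₂)
open import Data.Sum using (_⊎_; inj₁; inj₂)
import Data.Sum as Sum
open import Data.Empty using (⊥-elim)
open import Function using (id)
open import Function.Bundles using (Equivalence)
open import Function.Definitions using (Injective)
open import Relation.Binary.PropositionalEquality using (refl; cong; cong₂; subst; _≢_)
import Relation.Binary.PropositionalEquality as ≡
open import Relation.Binary.Construct.Closure.ReflexiveTransitive using (Star; ε; _◅_; _◅◅_; gmap)
open import Relation.Nullary using (Dec; yes; no; does)
open import Relation.Nullary.Decidable using (dec-true; dec-false)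

∨-true⁻ : ∀ {a b : Bool} → a ∨ b ≡ true → a ≡ true ⊎ b ≡ true
∨-true⁻ {true}  _ = inj₁ refl
∨-true⁻ {false} e = inj₂ e

∧-true⁻ : ∀ {a b : Bool} → a ∧ b ≡ true → a ≡ true × b ≡ true
∧-true⁻ {true} {true} _ = refl , refl

does-true⁻ : ∀ {A : Set} (a? : Dec A) → does a? ≡ true → A
does-true⁻ (yes a) _ = a

∈-tabulate⁺ : ∀ {n} {f : Fin n → Bool} {x : Fin n} → f x ≡ true → x ∈ tabulate f
∈-tabulate⁺ {f = f} {x} fx = lookup⇒[]= x (tabulate f) (≡.trans (lookup∘tabulate f x) fx)

∈-tabulate⁻ : ∀ {n} {f : Fin n → Bool} {x : Fin n} → x ∈ tabulate f → f x ≡ true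
∈-tabulate⁻ {f = f} {x} x∈ = ≡.trans (≡.sym (lookup∘tabulate f x)) ([]=⇒lookup x∈)

∣p∪q∣≤∣p∣+∣q∣ : ∀ {n} (p q : Subset n) → ∣ p ∪ q ∣ ≤ ∣ p ∣ + ∣ q ∣
∣p∪q∣≤∣p∣+∣q∣ []            []            = z≤n
∣p∪q∣≤∣p∣+∣q∣ (outside ∷ p) (outside ∷ q) = ∣p∪q∣≤∣p∣+∣q∣ p q
∣p∪q∣≤∣p∣+∣q∣ (inside  ∷ p) (outside ∷ q) = s≤s (∣p∪q∣≤∣p∣+∣q∣ p q)
∣p∪q∣≤∣p∣+∣q∣ (outside ∷ p) (inside  ∷ q) =
  subst (suc ∣ p ∪ q ∣ ≤_) (≡.sym (+-suc ∣ p ∣ ∣ q ∣)) (s≤s (∣p∪q∣≤∣p∣+∣q∣ p q))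
∣p∪q∣≤∣p∣+∣q∣ (inside  ∷ p) (inside  ∷ q) =
  s≤s (≤-trans (∣p∪q∣≤∣p∣+∣q∣ p q) (+-monoʳ-≤ ∣ p ∣ (n≤1+n ∣ q ∣)))

⊆∪⁅⁆⇒∣∣≤suc : ∀ {n} {p q : Subset n} {x : Fin n} → p ⊆ q ∪ ⁅ x ⁆ → ∣ p ∣ ≤ suc ∣ q ∣
⊆∪⁅⁆⇒∣∣≤suc {p = p} {q} {x} p⊆ = ≤-trans (p⊆q⇒∣p∣≤∣q∣ p⊆) (≤-trans (∣p∪q∣≤∣p∣+∣q∣ q ⁅ x ⁆) (≤-reflexive size))
  where
  size : ∣ q ∣ + ∣ ⁅ x ⁆ ∣ ≡ suc ∣ q ∣
  size = ≡.trans (cong (∣ q ∣ +_) (∣⁅x⁆∣≡1 x)) (+-comm ∣ q ∣ 1)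

∈⇒∣∣≢0 : ∀ {n} {p : Subset n} {x : Fin n} → x ∈ p → ∣ p ∣ ≢ 0
∈⇒∣∣≢0 {p = p} {x} x∈p ∣p∣≡0 = n≮0 (subst (∣ p - x ∣ <_) ∣p∣≡0 (x∈p⇒∣p-x∣<∣p∣ x∈p))

⊤-or-missing : ∀ {n} (p : Subset n) → p ≡ ⊤ ⊎ ∃ λ w → w ∉ p
⊤-or-missing {n} p with all? (_∈? p)
... | yes all∈ = inj₁ (⊆-antisym ⊆⊤ (λ {x} _ → all∈ x))
... | no ¬all  = inj₂ (¬∀⟶∃¬ n (_∈ p) (_∈? p) ¬all)

crossing-edge : ∀ {n} {E : Fin n → Fin n → Bool} (p : Subset n) {a b : Fin n} →
  Star (Edge E) a b → a ∈ p → b ∉ p →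
  Σ (Fin n) λ x → Σ (Fin n) λ y → x ∈ p × y ∉ p × Edge E x y
crossing-edge p ε a∈p a∉p = ⊥-elim (a∉p a∈p)
crossing-edge p (_◅_ {j = c} e walk) a∈p b∉p with c ∈? p
... | yes c∈p = crossing-edge p walk c∈p b∉p
... | no  c∉p = _ , c , a∈p , c∉p , e

-- A vertex whose neighbours all coincide (degree at most one) lies on no
-- cycle: its two cyclic neighbours would be equal, against injectivity.

inject₁²≢suc² : ∀ {m} (i : Fin m) → inject₁ (inject₁ i) ≢ suc (suc i)
inject₁²≢suc² zero    ()
inject₁²≢suc² (suc i) eq = inject₁²≢suc² i (suc-injective eq)

off-cycle : ∀ {n} {E : Fin n → Fin n → Bool} → (∀ x y → E x y ≡ E y x) →
  ∀ {v u : Fin n} → (∀ y → Edge E v y → y ≡ u) →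
  ∀ {k} (f : Fin (3 + k) → Fin n) → Injective _≡_ _≡_ f →
  (∀ (i : Fin (2 + k)) → Edge E (f (inject₁ i)) (f (suc i))) →
  Edge E (f (fromℕ (2 + k))) (f zero) →
  ∀ j → f j ≢ v
off-cycle {E = E} E-sym {v} {u} nbr f inj edges close = on-cycle
  where
  nbr-before : ∀ y → Edge E y v → y ≡ u
  nbr-before y e = nbr y (≡.trans (E-sym v y) e)

  same : ∀ {i j} → f i ≡ u → f j ≡ u → i ≡ j
  same fi fj = inj (≡.trans fi (≡.sym fj))

  on-cycle : ∀ j → f j ≢ v
  on-cycle zero refl = 0≢1+n (suc-injective (same (nbr _ (edges zero)) (nbr-before _ close)))
  on-cycle (suc j) fj≡v with view j
  ... | ‵fromℕ = 0≢1+n (≡.sym (same (nbr-before _ edges-in) (nbr _ edges-out)))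
    where
    edges-in  = subst (Edge E _) fj≡v (edges j)
    edges-out = subst (λ z → Edge E z _) fj≡v close
  ... | ‵inj₁ {i = i} _ = inject₁²≢suc² i (same (nbr-before _ edges-in) (nbr _ edges-out))
    where
    edges-in  = subst (Edge E _) fj≡v (edges (inject₁ i))
    edges-out = subst (λ z → Edge E z _) fj≡v (edges (suc i))

module _ {n : ℕ} {G : Graph n} where

  tree-connected : (S : Tree G) → ∀ x y → x ∈ vs (sub S) → y ∈ vs (sub S) → Star (Edge (es (sub S))) x y
  tree-connected S = proj₁ (proj₂ (isTree S))

  tree-acyclic : (S : Tree G) → ¬ HasCycle (es (sub S))
  tree-acyclic S = proj₂ (proj₂ (isTree S))

  tree-vertex : (S : Tree G) → Σ (Fin n) λ v → v ∈ vs (sub S)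
  tree-vertex S = proj₁ (isTree S)

  LeafSet : Subgraph G → Subset n
  LeafSet S = tabulate (λ v → lookup (vs S) v ∧ (degree S v ≡ᵇ 1))

  leaf⁻ : ∀ {S : Subgraph G} {x} → x ∈ LeafSet S → x ∈ vs S × degree S x ≡ 1
  leaf⁻ {S} {x} x∈ with ∧-true⁻ (∈-tabulate⁻ x∈)
  ... | x∈S , deg1 = lookup⇒[]= x (vs S) x∈S , ≡ᵇ⇒≡ (degree S x) 1 (Equivalence.from T-≡ deg1)

  leaf⁺ : ∀ {S : Subgraph G} {x} → x ∈ vs S → degree S x ≡ 1 → x ∈ LeafSet S
  leaf⁺ {S} {x} x∈S deg1 =
    ∈-tabulate⁺ (cong₂ _∧_ ([]=⇒lookup x∈S) (Equivalence.to T-≡ (≡⇒≡ᵇ (degree S x) 1 deg1)))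

  isolated⇒trivial : (S : Tree G) {u : Fin n} → u ∈ vs (sub S) → degree (sub S) u ≡ 0 → vs (sub S) ⊆ ⁅ u ⁆
  isolated⇒trivial S {u} u∈S deg0 {x} x∈S with tree-connected S u x u∈S x∈S
  ... | ε = x∈⁅x⁆ u
  ... | e ◅ _ = ⊥-elim (∈⇒∣∣≢0 {p = tabulate (es (sub S) u)} (∈-tabulate⁺ e) deg0)

module PendantExtension {n : ℕ} {G : Graph n} (S : Tree G) {u w : Fin n}
  (u∈S : u ∈ vs (sub S)) (w∉S : w ∉ vs (sub S)) (uw : Edge (adj G) u w) where

  V : Subset n
  V = vs (sub S)

  E : Fin n → Fin n → Bool
  E = es (sub S)

  u≢w : u ≢ w
  u≢w refl = w∉S u∈S

  w-isolated : ∀ {y} → ¬ Edge E w y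
  w-isolated {y} e = w∉S (es-vsˡ (sub S) w y e)

  pendant : Fin n → Fin n → Bool
  pendant x y = (does (x ≟ u) ∧ does (y ≟ w)) ∨ (does (x ≟ w) ∧ does (y ≟ u))

  pendant-sym : ∀ x y → pendant x y ≡ pendant y x
  pendant-sym x y =
    ≡.trans (cong₂ _∨_ (∧-comm (does (x ≟ u)) _) (∧-comm (does (x ≟ w)) _))
            (∨-comm (does (y ≟ w) ∧ does (x ≟ u)) _)

  pendant⁻ : ∀ {x y} → pendant x y ≡ true → (x ≡ u × y ≡ w) ⊎ (x ≡ w × y ≡ u)
  pendant⁻ {x} {y} e = Sum.map (ends (x ≟ u) (y ≟ w)) (ends (x ≟ w) (y ≟ u)) (∨-true⁻ e)
    where
    ends : ∀ {A B : Set} (a? : Dec A) (b? : Dec B) → does a? ∧ does b? ≡ true → A × B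
    ends a? b? t with ∧-true⁻ t
    ... | ta , tb = does-true⁻ a? ta , does-true⁻ b? tb

  pendant-away : ∀ {x} y → x ≢ u → x ≢ w → pendant x y ≡ false
  pendant-away {x} y x≢u x≢w rewrite dec-false (x ≟ u) x≢u | dec-false (x ≟ w) x≢w = refl

  E⁺ : Fin n → Fin n → Bool
  E⁺ x y = E x y ∨ pendant x y

  V⁺ : Subset n
  V⁺ = V ∪ ⁅ w ⁆

  old-edge : ∀ {x y} → Edge E x y → Edge E⁺ x y
  old-edge {x} {y} e rewrite e = refl

  old-walk : ∀ {x y} → Star (Edge E) x y → Star (Edge E⁺) x y
  old-walk = gmap id old-edge

  new-edge : Edge E⁺ u w
  new-edge rewrite dec-true (u ≟ u) refl | dec-true (w ≟ w) refl = ∨-zeroʳ (E u w)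

  E⁺-sym : ∀ x y → E⁺ x y ≡ E⁺ y x
  E⁺-sym x y = cong₂ _∨_ (es-sym (sub S) x y) (pendant-sym x y)

  E⁺⁻ : ∀ {x y} → Edge E⁺ x y → Edge E x y ⊎ (x ≡ u × y ≡ w) ⊎ (x ≡ w × y ≡ u)
  E⁺⁻ e = Sum.map₂ pendant⁻ (∨-true⁻ e)

  V⊆V⁺ : V ⊆ V⁺
  V⊆V⁺ = p⊆p∪q ⁅ w ⁆

  w∈V⁺ : w ∈ V⁺
  w∈V⁺ = q⊆p∪q V ⁅ w ⁆ (x∈⁅x⁆ w)

  V⁺⁻ : ∀ {x} → x ∈ V⁺ → x ∈ V ⊎ x ≡ w
  V⁺⁻ x∈ = Sum.map₂ (x∈⁅y⁆⇒x≡y w) (x∈p∪q⁻ V ⁅ w ⁆ x∈)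

  E⁺-adj : ∀ x y → E⁺ x y ≡ true → adj G x y ≡ true
  E⁺-adj x y e with E⁺⁻ e
  ... | inj₁ old                = es-adj (sub S) x y old
  ... | inj₂ (inj₁ (refl , refl)) = uw
  ... | inj₂ (inj₂ (refl , refl)) = ≡.trans (Graph.sym G w u) uw

  E⁺-vs : ∀ x y → E⁺ x y ≡ true → x ∈ V⁺
  E⁺-vs x y e with E⁺⁻ e
  ... | inj₁ old                = V⊆V⁺ (es-vsˡ (sub S) x y old)
  ... | inj₂ (inj₁ (refl , _))  = V⊆V⁺ u∈S
  ... | inj₂ (inj₂ (refl , _))  = w∈V⁺

  S⁺ : Subgraph G
  S⁺ = record { vs = V⁺ ; es = E⁺ ; es-sym = E⁺-sym ; es-adj = E⁺-adj ; es-vsˡ = E⁺-vs }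

  connected⁺ : ∀ x y → x ∈ V⁺ → y ∈ V⁺ → Star (Edge E⁺) x y
  connected⁺ x y x∈ y∈ with V⁺⁻ x∈ | V⁺⁻ y∈
  ... | inj₁ x∈S  | inj₁ y∈S  = old-walk (tree-connected S x y x∈S y∈S)
  ... | inj₁ x∈S  | inj₂ refl = old-walk (tree-connected S x u x∈S u∈S) ◅◅ (new-edge ◅ ε)
  ... | inj₂ refl | inj₁ y∈S  = ≡.trans (E⁺-sym w u) new-edge ◅ old-walk (tree-connected S u y u∈S y∈S)
  ... | inj₂ refl | inj₂ refl = ε

  w-neighbours : ∀ y → Edge E⁺ w y → y ≡ u
  w-neighbours y e with E⁺⁻ e
  ... | inj₁ old                = ⊥-elim (w-isolated old)
  ... | inj₂ (inj₁ (w≡u , _))   = ⊥-elim (u≢w (≡.sym w≡u))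
  ... | inj₂ (inj₂ (_ , y≡u))   = y≡u

  -- S + uw is acyclic: a cycle avoiding w is a cycle of S, and w, having
  -- only one neighbour, lies on no cycle.
  acyclic⁺ : ¬ HasCycle E⁺
  acyclic⁺ (k , f , inj , edges , close) with any? (λ j → f j ≟ w)
  ... | yes (j , fj≡w) = off-cycle E⁺-sym w-neighbours f inj edges close j fj≡w
  ... | no w∉cycle = tree-acyclic S (k , f , inj , (λ i → restrict (edges i)) , restrict close)
    where
    restrict : ∀ {i j} → Edge E⁺ (f i) (f j) → Edge E (f i) (f j)
    restrict {i} {j} e with E⁺⁻ e
    ... | inj₁ old              = old
    ... | inj₂ (inj₁ (_ , fj≡w)) = ⊥-elim (w∉cycle (j , fj≡w))
    ... | inj₂ (inj₂ (fi≡w , _)) = ⊥-elim (w∉cycle (i , fi≡w))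

  extension : Tree G
  extension = record { sub = S⁺ ; isTree = (u , V⊆V⁺ u∈S) , connected⁺ , acyclic⁺ }

  order-grows : order S < order extension
  order-grows = p⊂q⇒∣p∣<∣q∣ (V⊆V⁺ , w , w∈V⁺ , w∉S)

  degree-away : ∀ {x} → x ≢ u → x ≢ w → degree S⁺ x ≡ degree (sub S) x
  degree-away {x} x≢u x≢w = cong ∣_∣ (tabulate-cong no-new-edge)
    where
    no-new-edge : ∀ y → E⁺ x y ≡ E x y
    no-new-edge y = ≡.trans (cong (E x y ∨_) (pendant-away y x≢u x≢w)) (∨-identityʳ (E x y))

  degree-u-grows : degree (sub S) u < degree S⁺ u
  degree-u-grows = p⊂q⇒∣p∣<∣q∣ (N⊆N⁺ , w , ∈-tabulate⁺ new-edge , w∉N)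
    where
    N⊆N⁺ : tabulate (E u) ⊆ tabulate (E⁺ u)
    N⊆N⁺ y∈ = ∈-tabulate⁺ (old-edge (∈-tabulate⁻ y∈))

    w∉N : w ∉ tabulate (E u)
    w∉N w∈ = w-isolated (≡.trans (es-sym (sub S) w u) (∈-tabulate⁻ w∈))

  leaves-of-extension : 1 ≤ degree (sub S) u → LeafSet S⁺ ⊆ LeafSet (sub S) ∪ ⁅ w ⁆
  leaves-of-extension deg≥1 {x} x∈ with leaf⁻ {S = S⁺} x∈
  ... | x∈V⁺ , deg1 = classify (V⁺⁻ x∈V⁺) (x ≟ w) (x ≟ u)
    where
    classify : x ∈ V ⊎ x ≡ w → Dec (x ≡ w) → Dec (x ≡ u) → x ∈ LeafSet (sub S) ∪ ⁅ w ⁆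
    classify _          (yes x≡w) _         = q⊆p∪q (LeafSet (sub S)) ⁅ w ⁆ (subst (_∈ ⁅ w ⁆) (≡.sym x≡w) (x∈⁅x⁆ w))
    classify (inj₂ x≡w) (no x≢w)  _         = ⊥-elim (x≢w x≡w)
    classify (inj₁ _)   (no _)    (yes x≡u) =
      ⊥-elim (<⇒≱ (<-≤-trans (s≤s deg≥1) degree-u-grows) (≤-reflexive (subst (λ z → degree S⁺ z ≡ 1) x≡u deg1)))
    classify (inj₁ x∈S) (no x≢w)  (no x≢u)  =
      p⊆p∪q ⁅ w ⁆ (leaf⁺ {S = sub S} x∈S (≡.trans (≡.sym (degree-away x≢u x≢w)) deg1))

  -- If u had no neighbour, S was the single vertex u, so S + uw is an edge.
  leaves-of-edge : degree (sub S) u ≡ 0 → LeafSet S⁺ ⊆ ⁅ u ⁆ ∪ ⁅ w ⁆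
  leaves-of-edge deg0 {x} x∈ with V⁺⁻ (proj₁ (leaf⁻ {S = S⁺} x∈))
  ... | inj₁ x∈S  = p⊆p∪q ⁅ w ⁆ (isolated⇒trivial S u∈S deg0 x∈S)
  ... | inj₂ refl = q⊆p∪q ⁅ u ⁆ ⁅ w ⁆ (x∈⁅x⁆ w)

  -- Adding a pendant edge raises the number of leaves by at most one,
  -- except that a single vertex becomes a tree with two leaves.
  leaves-grow : leaves extension ≤ suc (leaves S) ⊔ 2
  leaves-grow with degree (sub S) u in deg
  ... | zero = ≤-trans (⊆∪⁅⁆⇒∣∣≤suc (leaves-of-edge deg))
                       (≤-trans (s≤s (≤-reflexive (∣⁅x⁆∣≡1 u))) (m≤n⊔m (suc (leaves S)) 2))
  ... | suc _ = ≤-trans (⊆∪⁅⁆⇒∣∣≤suc (leaves-of-extension (subst (1 ≤_) (≡.sym deg) (s≤s z≤n))))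
                        (m≤m⊔n (suc (leaves S)) 2)

module Growth {n : ℕ} {G : Graph n} (connected : Connected G) where

  extend : (S : Tree G) {w : Fin n} → w ∉ vs (sub S) →
    Σ (Tree G) λ S⁺ → order S < order S⁺ × leaves S⁺ ≤ suc (leaves S) ⊔ 2
  extend S {w} w∉S with tree-vertex S
  ... | v , v∈S with crossing-edge (vs (sub S)) (connected v w) v∈S w∉S
  ...   | x , y , x∈S , y∉S , xy = extension , order-grows , leaves-grow
    where open PendantExtension S x∈S y∉S xy

  -- Repeated extension; fuel bounds the number of steps, since each step
  -- adds a vertex and a tree has at most n vertices.
  grow : (k : ℕ) → 1 ≤ k → (fuel : ℕ) (S : Tree G) → n ≤ order S + fuel → leaves S ≤ k →
    (Σ (Tree G) λ S' → Spanning S' × leaves S' ≤ k) ⊎ (Σ (Tree G) λ S' → leaves S' ≡ suc k × order S < order S')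
  grow k 1≤k fuel S bound few with ⊤-or-missing (vs (sub S))
  ... | inj₁ spanning = inj₁ (S , spanning , few)
  ... | inj₂ (w , w∉S) with extend S w∉S
  ...   | S⁺ , S<S⁺ , leaves⁺ with m≤n⇒m<n∨m≡n (≤-trans leaves⁺ (⊔-lub (s≤s few) (s≤s 1≤k)))
  ...     | inj₂ exactly = inj₂ (S⁺ , exactly , S<S⁺)
  ...     | inj₁ fewer with fuel
  ...       | zero = ⊥-elim (<⇒≱ (<-≤-trans S<S⁺ (∣p∣≤n (vs (sub S⁺)))) (subst (n ≤_) (+-comm (order S) 0) bound))
  ...       | suc fuel′ = Sum.map₂ (λ (S' , k+1 , S⁺<S') → S' , k+1 , <-trans S<S⁺ S⁺<S')
                                   (grow k 1≤k fuel′ S⁺ bound⁺ (s≤s⁻¹ fewer))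
    where
    bound⁺ : n ≤ order S⁺ + fuel′
    bound⁺ = ≤-trans bound (≤-trans (≤-reflexive (+-suc (order S) fuel′)) (+-monoˡ-≤ fuel′ S<S⁺))

lemma2p1 : ∀ {n : ℕ} (G : Graph n) → Connected G →
    ¬ (Σ (Tree G) λ S → Spanning S × leaves S ≤ 4) →
    (T : Tree G) → MaximalTree5 G T →
    ¬ (Σ (Tree G) λ T' → leaves T' ≤ 4 × vs (sub T') ≡ vs (sub T))
lemma2p1 {n} G connected no-spanning T (_ , maximal) (T' , few , same-vertices)
  with Growth.grow connected 4 (s≤s z≤n) n T' (m≤n+m n (order T')) few
... | inj₁ spanning = no-spanning spanning
... | inj₂ (S , five , T'<S) = <⇒≱ T'<S (begin
        order S   ≤⟨ maximal S five ⟩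
        order T   ≡⟨ cong ∣_∣ (≡.sym same-vertices) ⟩
        order T'  ∎)
  where open ≤-Reasoning
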